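{- Let $n\ge1$ and $n=n_1+\dots+n_k+m_1+\dots+m_\ell+r$, where $n_1,\dots,n_k$ are odd positive integers, $m_1,\dots,m_\ell$ are even positive integers, and $k,\ell,r$ are nonnegative integers. (1) Let $f=\varphi_{n_1}\otimes\cdots\otimes\varphi_{n_k}\otimes\varphi_{m_1}\otimes\cdots\otimes\varphi_{m_\ell}\otimes I_r$. Then $f\in U_{[k+\ell,n-\ell]}(n)$ and $|f|=2^{k+\ell}$. Moreover, $\mathrm{Spec}(f)=\{k+\ell,k+\ell+1,\dots,n-\ell\}$ if $r>0$, and $\mathrm{Spec}(f)=\{k+\ell,k+\ell+2,\dots,n-\ell\}$ if $r=0$. (2) Let $f=\psi_{n_1}\otimes\cdots\otimes\psi_{n_k}\otimes\varphi_{m_1}\otimes\cdots\otimes\varphi_{m_\ell}\otimes I_r$. Then $f\in U_{[\ell,n-k-\ell]}(n)$ and $|f|=2^{k+\ell}$. Moreover, $\mathrm{Spec}(f)=\{\ell,\ell+1,\dots,n-k-\ell\}$ if $r>0$, and $\mathrm{Spec}(f)=\{\ell,\ell+2,\dots,n-k-\ell\}$ if $r=0$.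
   Context: The $n$-dimensional hypercube $H(n)$ has vertex set $\mathbb{Z}_2^n$, two vertices being adjacent iff they differ in exactly one coordinate; $N(x)$ is the set of neighbours of $x$. $U(n)$ is the real vector space of all functions $\mathbb{Z}_2^n\to\mathbb{R}$. For $0\le i\le n$, $U_i(n)=\{f\in U(n): (n-2i)f(x)=\sum_{y\in N(x)}f(y)\text{ for all }x\}$, and $U_{[i,j]}(n)=U_i(n)\oplus\cdots\oplus U_j(n)$. $|f|$ is the number of $x$ with $f(x)\ne0$. Every $f\in U(n)$ is uniquely $f=\sum_i f_i$ with $f_i\in U_i(n)$, and $\mathrm{Spec}(f)=\{i: f_i\not\equiv0\}$. For $f_1\in U(m)$, $f_2\in U(n)$, $(f_1\otimes f_2)(x,y)=f_1(x)f_2(y)$ for $x\in\mathbb{Z}_2^m,y\in\mathbb{Z}_2^n$, a function on $\mathbb{Z}_2^{m+n}=\mathbb{Z}_2^m\times\mathbb{Z}_2^n$; factors with zero count (e.g. $I_r$ when $r=0$) are omitted. For $k\ge1$, functions on $\mathbb{Z}_2^k$: $\varphi_k$ equals $1$ at the all-zeros vector, $-1$ at the all-ones vector, $0$ elsewhere; $\psi_k$ equals $1$ at the all-zeros and the all-ones vector, $0$ elsewhere; $I_k$ equals $1$ at the all-zeros vector, $0$ elsewhere.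
   Formalization: Functions in $U(n)$, including the components $f_i$ used for $\mathrm{Spec}(f)$ and for membership in $U_{[i,j]}(n)$, take values in ℚ rather than ℝ. -}

module Defs where

open import Data.Bool using (Bool; true; false; not; if_then_else_; _∧_)
open import Data.Nat using (ℕ; zero; suc; _+_; _*_; _∸_; _≤_; _<_)
open import Data.Fin using (Fin; toℕ)
import Data.Fin as Fin
open import Data.Vec using (Vec; []; _∷_; splitAt; updateAt)
open import Data.List using (List; []; _∷_; length; filter; concatMap; map)
open import Data.Nat.ListAction using (sum)
open import Data.Integer using (ℤ; +_) renaming (_-_ to _-ℤ_)
open import Data.Rational using (ℚ; 0ℚ; 1ℚ; -_; _/_; _≟_) renaming (_*_ to _*ℚ_; _+_ to _+ℚ_)
open import Data.Product using (Σ; _×_; _,_)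
open import Data.Sum using (_⊎_)
open import Relation.Binary.PropositionalEquality using (_≡_)
open import Relation.Nullary using (¬_; ¬?)

-- vertices of the hypercube H(n): Z_2^n as Vec Bool n (false = 0, true = 1)
Point : ℕ → Set
Point n = Vec Bool n

-- U(n): functions Z_2^n → ℝ.  All functions in the lemma (and all their
-- eigen-components) are rational valued, so we work over ℚ.
Func : ℕ → Set
Func n = Point n → ℚ

Σ[<_]_ : (n : ℕ) → (Fin n → ℚ) → ℚ
Σ[< zero ] f = 0ℚ
Σ[< suc n ] f = f Fin.zero +ℚ Σ[< n ] (λ j → f (Fin.suc j))

-- flip coordinate j: the neighbours of x are exactly flipAt x j, j < n
flipAt : ∀ {n} → Point n → Fin n → Point n
flipAt x j = updateAt x j not

nbrSum : ∀ {n} → Func n → Point n → ℚ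
nbrSum {n} f x = Σ[< n ] (λ j → f (flipAt x j))

coef : ℕ → ℕ → ℚ
coef n i = (+ n -ℤ + (2 * i)) / 1

InU : (n i : ℕ) → Func n → Set
InU n i f = ∀ x → coef n i *ℚ f x ≡ nbrSum f x

IsZero : ∀ {n} → Func n → Set
IsZero f = ∀ x → f x ≡ 0ℚ

IsDecomp : (n : ℕ) → Func n → (Fin (suc n) → Func n) → Set
IsDecomp n f g = (∀ i → InU n (toℕ i) (g i)) × (∀ x → f x ≡ Σ[< suc n ] (λ i → g i x))

InURange : (n a b : ℕ) → Func n → Set
InURange n a b f = Σ (Fin (suc n) → Func n) λ g →
  IsDecomp n f g × (∀ i → (toℕ i < a ⊎ b < toℕ i) → IsZero (g i))

-- i ∈ Spec(f) relative to the (unique) decomposition g: f_i ≢ 0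
InSpecVia : ∀ {n} → (Fin (suc n) → Func n) → Fin (suc n) → Set
InSpecVia g i = ¬ IsZero (g i)

allPoints : (n : ℕ) → List (Point n)
allPoints zero = [] ∷ []
allPoints (suc n) = concatMap (λ v → (false ∷ v) ∷ (true ∷ v) ∷ []) (allPoints n)

supp : ∀ {n} → Func n → ℕ
supp {n} f = length (filter (λ x → ¬? (f x ≟ 0ℚ)) (allPoints n))

_⊗_ : ∀ {m n} → Func m → Func n → Func (m + n)
_⊗_ {m} f g xy with splitAt m xy
... | x , y , _ = f x *ℚ g y

allFalse : ∀ {k} → Point k → Bool
allFalse [] = true
allFalse (b ∷ v) = not b ∧ allFalse v

allTrue : ∀ {k} → Point k → Bool
allTrue [] = true
allTrue (b ∷ v) = b ∧ allTrue v

φ : (k : ℕ) → Func k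
φ k x = if allFalse x then 1ℚ else (if allTrue x then - 1ℚ else 0ℚ)

ψ : (k : ℕ) → Func k
ψ k x = if allFalse x then 1ℚ else (if allTrue x then 1ℚ else 0ℚ)

I : (k : ℕ) → Func k
I k x = if allFalse x then 1ℚ else 0ℚ

-- iterated tensor product h_{n_1} ⊗ ... ⊗ h_{n_k} over a list of sizes;
-- the empty tensor product is the constant 1 on Z_2^0 (i.e. the factor is omitted)
⊗List : (h : (k : ℕ) → Func k) → (ns : List ℕ) → Func (sum ns)
⊗List h [] x = 1ℚ
⊗List h (k ∷ ns) = h k ⊗ ⊗List h ns

Odd Even : ℕ → Set
Odd n = Σ ℕ λ t → n ≡ suc (2 * t)
Even n = Σ ℕ λ t → n ≡ 2 * t

data AllPos (P : ℕ → Set) : List ℕ → Set where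
  []  : AllPos P []
  _∷_ : ∀ {k ks} → (0 < k × P k) → AllPos P ks → AllPos P (k ∷ ks)

InInterval : ℕ → ℕ → ℕ → Set
InInterval a b i = a ≤ i × i ≤ b

InStep2 : ℕ → ℕ → ℕ → Set
InStep2 a b i = (Σ ℕ λ t → i ≡ a + 2 * t) × i ≤ b

Conclusion : (n : ℕ) → Func n → (a b s r : ℕ) → Set
Conclusion n f a b s r =
  InURange n a b f
  × supp f ≡ s
  × (∀ g → IsDecomp n f g → ∀ i →
       (0 < r → (InSpecVia g i → InInterval a b (toℕ i)) × (InInterval a b (toℕ i) → InSpecVia g i))
     × (r ≡ 0 → (InSpecVia g i → InStep2 a b (toℕ i)) × (InStep2 a b (toℕ i) → InSpecVia g i)))

-- Split a function on Z₂^(1+n) along its first coordinate as f = 1 ⊗ f⁺ + χ ⊗ f⁻ with χ = (1, −1).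
-- Since 1 and χ are eigenfunctions of H(1) for the eigenvalues 1 and −1, the i-th eigencomponent of f
-- is 1 ⊗ f⁺ᵢ + χ ⊗ f⁻ᵢ₋₁, so Spec f = Spec f⁺ ∪ (Spec f⁻ + 1). The factors reproduce themselves under
-- this splitting: φₖ₊₁⁺ = ½ φₖ, φₖ₊₁⁻ = ½ ψₖ, ψₖ₊₁⁺ = ½ ψₖ, ψₖ₊₁⁻ = ½ φₖ and Iₖ₊₁^± = ½ Iₖ. Peeling the
-- coordinates of the factors off one at a time, every spectrum stays a ladder {A, A + g, …, B}, with
-- g = 1 as soon as I_r contributes an interval (r > 0) and g = 2 otherwise, and its ends move exactly as
-- in the statement. The same splitting proves that the eigen-decomposition is unique: it shifts all
-- eigenvalues of the restricted eigenfunctions by the same ±1, so induction on n shows that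
-- eigenfunctions for distinct eigenvalues are independent. Support sizes multiply under ⊗.

module Submission where

open import Defs
open import Data.Nat using (ℕ; _+_; _∸_; _^_; _≤_)
open import Data.List using (List; length)
open import Data.Nat.ListAction using (sum)
open import Data.Product using (_×_)

open import Level using (0ℓ)
open import Function using (_∘_)
open import Function.Definitions using (Injective)
open import Data.Empty using (⊥; ⊥-elim)
open import Data.Sum using (_⊎_; inj₁; inj₂)
open import Data.Product using (Σ; _,_; proj₁; proj₂)
open import Data.Bool using (Bool; true; false; not; if_then_else_)
open import Data.Nat using (zero; suc; pred; _*_; _<_; z≤n; s≤s; _≤?_)
import Data.Nat.Properties as ℕ
import Data.Nat.Tactic.RingSolver as ℕ-Ring
open import Data.Nat.Divisibility using (_∣?_; divides)
open import Data.Integer using (+_; -[1+_]) renaming (_+_ to _+ℤ_; _-_ to _-ℤ_)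
import Data.Integer.Properties as ℤ
import Data.Integer.Tactic.RingSolver as ℤ-Ring
open import Data.Rational using (ℚ; 0ℚ; 1ℚ; ½; -_; _≟_; 1/_; ↥_; ≢-nonZero)
  renaming (_+_ to _+ℚ_; _-_ to _-ℚ_; _*_ to _*ℚ_)
import Data.Rational.Properties as ℚ
open import Data.Rational.Literals using (fromℤ)
open import Algebra.Properties.Group ℚ.+-0-group using (∙-cancelʳ; x∙y⁻¹≈ε⇒x≈y)
open import Tactic.RingSolver.Core.AlmostCommutativeRing using (AlmostCommutativeRing; fromCommutativeRing)
open import Tactic.RingSolver using (solve-∀)
open import Data.Fin using (Fin; toℕ) renaming (zero to fzero; suc to fsuc)
open import Data.Fin.Properties using (toℕ-injective; suc-injective)
open import Data.Vec using ([]; _∷_; take; drop)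
open import Data.List using ([]; _∷_; filter; concatMap; map)
open import Data.List.Properties using (filter-≐; filter-none; filter-accept)
open import Data.List.Relation.Unary.All using (universal)
open import Relation.Nullary using (¬_; ¬?; Dec; yes; no; does)
open import Relation.Nullary.Decidable using (dec⇒maybe; _×-dec_; decidable-stable)
open import Relation.Unary using (Pred; _⊆_; _≐_; _∪_; ∅; Decidable)
open import Relation.Binary.PropositionalEquality

ℚ-ring : AlmostCommutativeRing 0ℓ 0ℓ
ℚ-ring = fromCommutativeRing ℚ.+-*-commutativeRing (λ x → dec⇒maybe (0ℚ ≟ x))

*-cancelˡ-≢0 : ∀ {c a} → c ≢ 0ℚ → c *ℚ a ≡ 0ℚ → a ≡ 0ℚ
*-cancelˡ-≢0 {c} {a} c≢0 ca≡0 = begin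
    a                    ≡⟨ sym (ℚ.*-identityˡ a) ⟩
    1ℚ *ℚ a              ≡⟨ cong (_*ℚ a) (sym (ℚ.*-inverseˡ c)) ⟩
    (1/ c *ℚ c) *ℚ a     ≡⟨ ℚ.*-assoc (1/ c) c a ⟩
    1/ c *ℚ (c *ℚ a)     ≡⟨ cong (1/ c *ℚ_) ca≡0 ⟩
    1/ c *ℚ 0ℚ           ≡⟨ ℚ.*-zeroʳ (1/ c) ⟩
    0ℚ                   ∎
  where
    open ≡-Reasoning
    instance _ = ≢-nonZero c≢0

½≢0 : ½ ≢ 0ℚ
½≢0 ()

-- Finite sums

Σ-zero : ∀ n {f : Fin n → ℚ} → (∀ j → f j ≡ 0ℚ) → Σ[< n ] f ≡ 0ℚ
Σ-zero zero    z = refl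
Σ-zero (suc n) z = cong₂ _+ℚ_ (z fzero) (Σ-zero n (z ∘ fsuc))

Σ-distrib-+ : ∀ n (f g : Fin n → ℚ) → Σ[< n ] (λ j → f j +ℚ g j) ≡ Σ[< n ] f +ℚ Σ[< n ] g
Σ-distrib-+ zero    f g = refl
Σ-distrib-+ (suc n) f g =
  trans (cong (f fzero +ℚ g fzero +ℚ_) (Σ-distrib-+ n (f ∘ fsuc) (g ∘ fsuc)))
        (interchange (f fzero) (g fzero) _ _)
  where
    interchange : ∀ a b c d → (a +ℚ b) +ℚ (c +ℚ d) ≡ (a +ℚ c) +ℚ (b +ℚ d)
    interchange = solve-∀ ℚ-ring

Σ-neg : ∀ n (f : Fin n → ℚ) → Σ[< n ] (λ j → - f j) ≡ - Σ[< n ] f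
Σ-neg zero    f = refl
Σ-neg (suc n) f = trans (cong (- f fzero +ℚ_) (Σ-neg n (f ∘ fsuc)))
                        (sym (ℚ.neg-distrib-+ (f fzero) _))

Σ-distribˡ-* : ∀ n q (f : Fin n → ℚ) → Σ[< n ] (λ j → q *ℚ f j) ≡ q *ℚ Σ[< n ] f
Σ-distribˡ-* zero    q f = sym (ℚ.*-zeroʳ q)
Σ-distribˡ-* (suc n) q f = trans (cong (q *ℚ f fzero +ℚ_) (Σ-distribˡ-* n q (f ∘ fsuc)))
                                 (sym (ℚ.*-distribˡ-+ q (f fzero) _))

Σ-single : ∀ n (f : Fin n → ℚ) j → (∀ j′ → j′ ≢ j → f j′ ≡ 0ℚ) → Σ[< n ] f ≡ f j
Σ-single (suc n) f fzero others =
  trans (cong (f fzero +ℚ_) (Σ-zero n (λ j′ → others (fsuc j′) (λ ()))))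
        (ℚ.+-identityʳ (f fzero))
Σ-single (suc n) f (fsuc j) others =
  trans (cong₂ _+ℚ_ (others fzero (λ ()))
                    (Σ-single n (f ∘ fsuc) j (λ j′ j′≢j → others (fsuc j′) (j′≢j ∘ suc-injective))))
        (ℚ.+-identityˡ (f (fsuc j)))

Σ-last : ∀ n (g : ℕ → ℚ) → Σ[< suc n ] (g ∘ toℕ) ≡ Σ[< n ] (g ∘ toℕ) +ℚ g n
Σ-last zero    g = trans (ℚ.+-identityʳ (g 0)) (sym (ℚ.+-identityˡ (g 0)))
Σ-last (suc n) g = trans (cong (g 0 +ℚ_) (Σ-last n (g ∘ suc)))
                         (sym (ℚ.+-assoc (g 0) _ (g (suc n))))

-- Eigenfunctions

coef-fromℤ : ∀ n i → coef n i ≡ fromℤ (+ n -ℤ + (2 * i))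
coef-fromℤ n i = ℚ.↥p/↧p≡p (fromℤ (+ n -ℤ + (2 * i)))

fromℤ-+ : ∀ p q → fromℤ (p +ℤ q) ≡ fromℤ p +ℚ fromℤ q
fromℤ-+ p q = trans (sym (ℚ.↥p/↧p≡p (fromℤ (p +ℤ q))))
                    (ℚ./-cong (sym (cong₂ _+ℤ_ (ℤ.*-identityʳ p) (ℤ.*-identityʳ q))) refl)

coef-suc : ∀ n i → coef (suc n) i ≡ coef n i +ℚ 1ℚ
coef-suc n i = begin
    coef (suc n) i                     ≡⟨ coef-fromℤ (suc n) i ⟩
    fromℤ (+ (1 + n) -ℤ + (2 * i))      ≡⟨ cong (λ m → fromℤ (m -ℤ + (2 * i))) (ℤ.pos-+ 1 n) ⟩
    fromℤ ((+ 1 +ℤ + n) -ℤ + (2 * i))   ≡⟨ cong fromℤ (shuffle (+ n) (+ (2 * i))) ⟩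
    fromℤ (z +ℤ + 1)                    ≡⟨ fromℤ-+ z (+ 1) ⟩
    fromℤ z +ℚ 1ℚ                       ≡⟨ cong (_+ℚ 1ℚ) (sym (coef-fromℤ n i)) ⟩
    coef n i +ℚ 1ℚ                      ∎
  where
    open ≡-Reasoning
    z = + n -ℤ + (2 * i)
    shuffle : ∀ a b → (+ 1 +ℤ a) -ℤ b ≡ (a -ℤ b) +ℤ + 1
    shuffle = ℤ-Ring.solve-∀

coef-suc-suc : ∀ n i → coef (suc n) (suc i) ≡ coef n i -ℚ 1ℚ
coef-suc-suc n i = begin
    coef (suc n) (suc i)                        ≡⟨ coef-fromℤ (suc n) (suc i) ⟩
    fromℤ (+ (1 + n) -ℤ + (2 * suc i))           ≡⟨ cong (λ m → fromℤ (+ (1 + n) -ℤ + m)) (ℕ.*-suc 2 i) ⟩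
    fromℤ (+ (1 + n) -ℤ + (2 + 2 * i))           ≡⟨ cong₂ (λ u v → fromℤ (u -ℤ v))
                                                         (ℤ.pos-+ 1 n) (ℤ.pos-+ 2 (2 * i)) ⟩
    fromℤ ((+ 1 +ℤ + n) -ℤ (+ 2 +ℤ + (2 * i)))    ≡⟨ cong fromℤ (shuffle (+ n) (+ (2 * i))) ⟩
    fromℤ (z +ℤ -[1+ 0 ])                        ≡⟨ fromℤ-+ z -[1+ 0 ] ⟩
    fromℤ z -ℚ 1ℚ                                ≡⟨ cong (_-ℚ 1ℚ) (sym (coef-fromℤ n i)) ⟩
    coef n i -ℚ 1ℚ                               ∎
  where
    open ≡-Reasoning
    z = + n -ℤ + (2 * i)
    shuffle : ∀ a b → (+ 1 +ℤ a) -ℤ (+ 2 +ℤ b) ≡ (a -ℤ b) +ℤ -[1+ 0 ]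
    shuffle = ℤ-Ring.solve-∀

coef-injective : ∀ n {i j} → coef n i ≡ coef n j → i ≡ j
coef-injective n {i} {j} e = ℕ.*-cancelˡ-≡ i j 2 (ℤ.+-injective (begin
    + (2 * i)                       ≡⟨ double-negation (+ n) (+ (2 * i)) ⟩
    + n -ℤ (+ n -ℤ + (2 * i))       ≡⟨ cong (+ n -ℤ_) ↥-equal ⟩
    + n -ℤ (+ n -ℤ + (2 * j))       ≡⟨ sym (double-negation (+ n) (+ (2 * j))) ⟩
    + (2 * j)                       ∎))
  where
    open ≡-Reasoning
    ↥-equal : + n -ℤ + (2 * i) ≡ + n -ℤ + (2 * j)
    ↥-equal = cong ↥_ (trans (sym (coef-fromℤ n i)) (trans e (coef-fromℤ n j)))
    double-negation : ∀ a b → b ≡ a -ℤ (a -ℤ b)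
    double-negation = ℤ-Ring.solve-∀

infixl 7 _·_
infixl 6 _⊕_

_·_ : ∀ {n} → ℚ → Func n → Func n
(q · f) x = q *ℚ f x

_⊕_ : ∀ {n} → Func n → Func n → Func n
(f ⊕ g) x = f x +ℚ g x

part⁺ part⁻ : ∀ {n} → Func (suc n) → Func n
part⁺ f y = ½ *ℚ (f (false ∷ y) +ℚ f (true ∷ y))
part⁻ f y = ½ *ℚ (f (false ∷ y) -ℚ f (true ∷ y))

sign : Bool → ℚ
sign false = 1ℚ
sign true  = - 1ℚ

-- lift⁺ h = 1 ⊗ h and lift⁻ h = χ ⊗ h, where χ(0) = 1 and χ(1) = −1.
lift⁺ lift⁻ : ∀ {n} → Func n → Func (suc n)
lift⁺ h (b ∷ y) = h y
lift⁻ h (b ∷ y) = sign b *ℚ h y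

lift-parts : ∀ {n} (f : Func (suc n)) → f ≗ lift⁺ (part⁺ f) ⊕ lift⁻ (part⁻ f)
lift-parts f (false ∷ y) = recover₀ (f (false ∷ y)) (f (true ∷ y))
  where
    recover₀ : ∀ a b → a ≡ ½ *ℚ (a +ℚ b) +ℚ 1ℚ *ℚ (½ *ℚ (a -ℚ b))
    recover₀ = solve-∀ ℚ-ring
lift-parts f (true ∷ y) = recover₁ (f (false ∷ y)) (f (true ∷ y))
  where
    recover₁ : ∀ a b → b ≡ ½ *ℚ (a +ℚ b) +ℚ (- 1ℚ) *ℚ (½ *ℚ (a -ℚ b))
    recover₁ = solve-∀ ℚ-ring

vanish-lifts : ∀ {n} {a b : Func n} → IsZero a → IsZero b → IsZero (lift⁺ a ⊕ lift⁻ b)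
vanish-lifts za zb (s ∷ y) =
  trans (cong₂ (λ u v → u +ℚ sign s *ℚ v) (za y) (zb y)) (cong (0ℚ +ℚ_) (ℚ.*-zeroʳ (sign s)))

lifts-vanish : ∀ {n} {a b : Func n} → IsZero (lift⁺ a ⊕ lift⁻ b) → IsZero a × IsZero b
lifts-vanish {a = a} {b} z =
    (λ y → trans (first (a y) (b y)) (cong₂ (λ u v → ½ *ℚ (u +ℚ v)) (z (false ∷ y)) (z (true ∷ y))))
  , (λ y → trans (second (a y) (b y)) (cong₂ (λ u v → ½ *ℚ (u -ℚ v)) (z (false ∷ y)) (z (true ∷ y))))
  where
    first : ∀ a b → a ≡ ½ *ℚ ((a +ℚ 1ℚ *ℚ b) +ℚ (a +ℚ (- 1ℚ) *ℚ b))
    first = solve-∀ ℚ-ring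
    second : ∀ a b → b ≡ ½ *ℚ ((a +ℚ 1ℚ *ℚ b) -ℚ (a +ℚ (- 1ℚ) *ℚ b))
    second = solve-∀ ℚ-ring

part⁺-· : ∀ {n c} {f f′ : Func (suc n)} → f ≗ c · f′ → part⁺ f ≗ c · part⁺ f′
part⁺-· {c = c} {f′ = f′} e y =
  trans (cong₂ (λ u v → ½ *ℚ (u +ℚ v)) (e _) (e _))
        (factor c (f′ (false ∷ y)) (f′ (true ∷ y)))
  where
    factor : ∀ c a b → ½ *ℚ (c *ℚ a +ℚ c *ℚ b) ≡ c *ℚ (½ *ℚ (a +ℚ b))
    factor = solve-∀ ℚ-ring

part⁻-· : ∀ {n c} {f f′ : Func (suc n)} → f ≗ c · f′ → part⁻ f ≗ c · part⁻ f′
part⁻-· {c = c} {f′ = f′} e y =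
  trans (cong₂ (λ u v → ½ *ℚ (u -ℚ v)) (e _) (e _))
        (factor c (f′ (false ∷ y)) (f′ (true ∷ y)))
  where
    factor : ∀ c a b → ½ *ℚ (c *ℚ a -ℚ c *ℚ b) ≡ c *ℚ (½ *ℚ (a -ℚ b))
    factor = solve-∀ ℚ-ring

Σ-part⁺ : ∀ {n} m (h : Fin m → Func (suc n)) y
        → Σ[< m ] (λ j → part⁺ (h j) y) ≡ part⁺ (λ x → Σ[< m ] (λ j → h j x)) y
Σ-part⁺ m h y = trans (Σ-distribˡ-* m ½ _)
                      (cong (½ *ℚ_) (Σ-distrib-+ m (λ j → h j (false ∷ y)) (λ j → h j (true ∷ y))))

Σ-part⁻ : ∀ {n} m (h : Fin m → Func (suc n)) y
        → Σ[< m ] (λ j → part⁻ (h j) y) ≡ part⁻ (λ x → Σ[< m ] (λ j → h j x)) y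
Σ-part⁻ m h y = trans (Σ-distribˡ-* m ½ _) (cong (½ *ℚ_) (begin
    Σ[< m ] (λ j → h j (false ∷ y) -ℚ h j (true ∷ y))
      ≡⟨ Σ-distrib-+ m (λ j → h j (false ∷ y)) (λ j → - h j (true ∷ y)) ⟩
    Σ[< m ] (λ j → h j (false ∷ y)) +ℚ Σ[< m ] (λ j → - h j (true ∷ y))
      ≡⟨ cong (Σ[< m ] (λ j → h j (false ∷ y)) +ℚ_) (Σ-neg m (λ j → h j (true ∷ y))) ⟩
    Σ[< m ] (λ j → h j (false ∷ y)) -ℚ Σ[< m ] (λ j → h j (true ∷ y)) ∎))
  where open ≡-Reasoning

IsEigen : (n : ℕ) → ℚ → Func n → Set
IsEigen n c f = ∀ x → c *ℚ f x ≡ nbrSum f x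

eigen-⊕ : ∀ {n c} {f g : Func n} → IsEigen n c f → IsEigen n c g → IsEigen n c (f ⊕ g)
eigen-⊕ {n} {c} {f} {g} ef eg x =
  trans (ℚ.*-distribˡ-+ c (f x) (g x))
        (trans (cong₂ _+ℚ_ (ef x) (eg x))
               (sym (Σ-distrib-+ n (λ j → f (flipAt x j)) (λ j → g (flipAt x j)))))

eigen-neg : ∀ {n c} {f : Func n} → IsEigen n c f → IsEigen n c (λ x → - f x)
eigen-neg {n} {c} {f} ef x =
  trans (sym (ℚ.neg-distribʳ-* c (f x)))
        (trans (cong -_ (ef x)) (sym (Σ-neg n (λ j → f (flipAt x j)))))

eigen-lift⁺ : ∀ {n c} {h : Func n} → IsEigen n c h → IsEigen (suc n) (c +ℚ 1ℚ) (lift⁺ h)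
eigen-lift⁺ {c = c} {h} eh (b ∷ y) = trans (spread c (h y)) (cong (h y +ℚ_) (eh y))
  where
    spread : ∀ c a → (c +ℚ 1ℚ) *ℚ a ≡ a +ℚ c *ℚ a
    spread = solve-∀ ℚ-ring

sign-not : ∀ b → sign (not b) ≡ - sign b
sign-not false = refl
sign-not true  = refl

eigen-lift⁻ : ∀ {n c} {h : Func n} → IsEigen n c h → IsEigen (suc n) (c -ℚ 1ℚ) (lift⁻ h)
eigen-lift⁻ {n} {c} {h} eh (b ∷ y) = begin
    (c -ℚ 1ℚ) *ℚ (sign b *ℚ h y)
      ≡⟨ spread c (sign b) (h y) ⟩
    (- sign b) *ℚ h y +ℚ sign b *ℚ (c *ℚ h y)
      ≡⟨ cong₂ (λ s v → s *ℚ h y +ℚ sign b *ℚ v) (sym (sign-not b)) (eh y) ⟩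
    sign (not b) *ℚ h y +ℚ sign b *ℚ nbrSum h y
      ≡⟨ cong (sign (not b) *ℚ h y +ℚ_) (sym (Σ-distribˡ-* n (sign b) (λ j → h (flipAt y j)))) ⟩
    nbrSum (lift⁻ h) (b ∷ y) ∎
  where
    open ≡-Reasoning
    spread : ∀ c s a → (c -ℚ 1ℚ) *ℚ (s *ℚ a) ≡ (- s) *ℚ a +ℚ s *ℚ (c *ℚ a)
    spread = solve-∀ ℚ-ring

eigen-part⁺ : ∀ {n c} {h : Func (suc n)} → IsEigen (suc n) c h → IsEigen n (c -ℚ 1ℚ) (part⁺ h)
eigen-part⁺ {n} {c} {h} eh y = begin
    (c -ℚ 1ℚ) *ℚ part⁺ h y
      ≡⟨ expand c h₀ h₁ ⟩
    ½ *ℚ ((c *ℚ h₀ -ℚ h₁) +ℚ (c *ℚ h₁ -ℚ h₀))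
      ≡⟨ cong₂ (λ u v → ½ *ℚ ((u -ℚ h₁) +ℚ (v -ℚ h₀))) (eh (false ∷ y)) (eh (true ∷ y)) ⟩
    ½ *ℚ (((h₁ +ℚ N₀) -ℚ h₁) +ℚ ((h₀ +ℚ N₁) -ℚ h₀))
      ≡⟨ cancel h₀ h₁ N₀ N₁ ⟩
    ½ *ℚ (N₀ +ℚ N₁)
      ≡⟨ sym (Σ-part⁺ n (λ j x → h (flipAt x (fsuc j))) y) ⟩
    nbrSum (part⁺ h) y ∎
  where
    open ≡-Reasoning
    h₀ = h (false ∷ y)
    h₁ = h (true ∷ y)
    N₀ = nbrSum (λ z → h (false ∷ z)) y
    N₁ = nbrSum (λ z → h (true ∷ z)) y
    expand : ∀ c a b → (c -ℚ 1ℚ) *ℚ (½ *ℚ (a +ℚ b))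
                     ≡ ½ *ℚ ((c *ℚ a -ℚ b) +ℚ (c *ℚ b -ℚ a))
    expand = solve-∀ ℚ-ring
    cancel : ∀ a b u v → ½ *ℚ (((b +ℚ u) -ℚ b) +ℚ ((a +ℚ v) -ℚ a)) ≡ ½ *ℚ (u +ℚ v)
    cancel = solve-∀ ℚ-ring

eigen-part⁻ : ∀ {n c} {h : Func (suc n)} → IsEigen (suc n) c h → IsEigen n (c +ℚ 1ℚ) (part⁻ h)
eigen-part⁻ {n} {c} {h} eh y = begin
    (c +ℚ 1ℚ) *ℚ part⁻ h y
      ≡⟨ expand c h₀ h₁ ⟩
    ½ *ℚ ((c *ℚ h₀ -ℚ h₁) -ℚ (c *ℚ h₁ -ℚ h₀))
      ≡⟨ cong₂ (λ u v → ½ *ℚ ((u -ℚ h₁) -ℚ (v -ℚ h₀))) (eh (false ∷ y)) (eh (true ∷ y)) ⟩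
    ½ *ℚ (((h₁ +ℚ N₀) -ℚ h₁) -ℚ ((h₀ +ℚ N₁) -ℚ h₀))
      ≡⟨ cancel h₀ h₁ N₀ N₁ ⟩
    ½ *ℚ (N₀ -ℚ N₁)
      ≡⟨ sym (Σ-part⁻ n (λ j x → h (flipAt x (fsuc j))) y) ⟩
    nbrSum (part⁻ h) y ∎
  where
    open ≡-Reasoning
    h₀ = h (false ∷ y)
    h₁ = h (true ∷ y)
    N₀ = nbrSum (λ z → h (false ∷ z)) y
    N₁ = nbrSum (λ z → h (true ∷ z)) y
    expand : ∀ c a b → (c +ℚ 1ℚ) *ℚ (½ *ℚ (a -ℚ b))
                     ≡ ½ *ℚ ((c *ℚ a -ℚ b) -ℚ (c *ℚ b -ℚ a))
    expand = solve-∀ ℚ-ring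
    cancel : ∀ a b u v → ½ *ℚ (((b +ℚ u) -ℚ b) -ℚ ((a +ℚ v) -ℚ a)) ≡ ½ *ℚ (u -ℚ v)
    cancel = solve-∀ ℚ-ring

-- part⁺ and part⁻ shift every eigenvalue by −1 and +1, so they keep the eigenvalues distinct.
eigen-independent : ∀ n {m} (c : Fin m → ℚ) → Injective _≡_ _≡_ c → (h : Fin m → Func n)
  → (∀ j → IsEigen n (c j) (h j)) → (∀ x → Σ[< m ] (λ j → h j x) ≡ 0ℚ)
  → ∀ j → IsZero (h j)
eigen-independent zero {m} c c-inj h eh total j [] with c j ≟ 0ℚ
... | no cj≢0  = *-cancelˡ-≢0 cj≢0 (eh j [])
... | yes cj≡0 = trans (sym (Σ-single m (λ j′ → h j′ []) j others)) (total [])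
  where
    others : ∀ j′ → j′ ≢ j → h j′ [] ≡ 0ℚ
    others j′ j′≢j =
      *-cancelˡ-≢0 (λ cj′≡0 → j′≢j (c-inj (trans cj′≡0 (sym cj≡0)))) (eh j′ [])
eigen-independent (suc n) {m} c c-inj h eh total j x =
  trans (lift-parts (h j) x) (vanish-lifts (vanish⁺ j) (vanish⁻ j) x)
  where
    vanish⁺ : ∀ j → IsZero (part⁺ (h j))
    vanish⁺ = eigen-independent n (λ j → c j -ℚ 1ℚ)
                (λ {i} {i′} e → c-inj (∙-cancelʳ (- 1ℚ) (c i) (c i′) e))
                (part⁺ ∘ h) (λ j → eigen-part⁺ {c = c j} {h j} (eh j))
                (λ y → trans (Σ-part⁺ m h y) (cong₂ (λ u v → ½ *ℚ (u +ℚ v)) (total _) (total _)))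
    vanish⁻ : ∀ j → IsZero (part⁻ (h j))
    vanish⁻ = eigen-independent n (λ j → c j +ℚ 1ℚ)
                (λ {i} {i′} e → c-inj (∙-cancelʳ 1ℚ (c i) (c i′) e))
                (part⁻ ∘ h) (λ j → eigen-part⁻ {c = c j} {h j} (eh j))
                (λ y → trans (Σ-part⁻ m h y) (cong₂ (λ u v → ½ *ℚ (u -ℚ v)) (total _) (total _)))

-- The canonical decomposition

component : ∀ n → Func n → ℕ → Func n
component zero    f zero    = f
component zero    f (suc i) = λ _ → 0ℚ
component (suc n) f zero    = lift⁺ (component n (part⁺ f) zero)
component (suc n) f (suc i) =
  lift⁺ (component n (part⁺ f) (suc i)) ⊕ lift⁻ (component n (part⁻ f) i)

component-eigen : ∀ n f i → IsEigen n (coef n i) (component n f i)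
component-eigen zero    f zero    [] = ℚ.*-zeroˡ (f [])
component-eigen zero    f (suc i) [] = ℚ.*-zeroʳ (coef 0 (suc i))
component-eigen (suc n) f zero =
  subst (λ c → IsEigen (suc n) c (component (suc n) f zero)) (sym (coef-suc n 0))
        (eigen-lift⁺ {c = coef n 0} (component-eigen n (part⁺ f) 0))
component-eigen (suc n) f (suc i) = eigen-⊕ {c = coef (suc n) (suc i)} {F⁺} {F⁻}
  (subst (λ c → IsEigen (suc n) c F⁺) (sym (coef-suc n (suc i)))
         (eigen-lift⁺ {c = coef n (suc i)} (component-eigen n (part⁺ f) (suc i))))
  (subst (λ c → IsEigen (suc n) c F⁻) (sym (coef-suc-suc n i))
         (eigen-lift⁻ {c = coef n i} (component-eigen n (part⁻ f) i)))
  where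
    F⁺ = lift⁺ (component n (part⁺ f) (suc i))
    F⁻ = lift⁻ (component n (part⁻ f) i)

component-above : ∀ n f i → n < i → IsZero (component n f i)
component-above zero    f (suc i) _         x = refl
component-above (suc n) f (suc i) (s≤s n<i) =
  vanish-lifts (component-above n (part⁺ f) (suc i) (ℕ.m<n⇒m<1+n n<i))
               (component-above n (part⁻ f) i n<i)

component-sum : ∀ n f x → f x ≡ Σ[< suc n ] (λ i → component n f (toℕ i) x)
component-sum zero    f x       = sym (ℚ.+-identityʳ (f x))
component-sum (suc n) f (b ∷ y) = begin
    f (b ∷ y)
      ≡⟨ lift-parts f (b ∷ y) ⟩
    part⁺ f y +ℚ sign b *ℚ part⁻ f y
      ≡⟨ cong₂ (λ u v → u +ℚ sign b *ℚ v) sum⁺ (component-sum n (part⁻ f) y) ⟩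
    (C⁺ 0 +ℚ Σ[< suc n ] (C⁺ ∘ suc ∘ toℕ)) +ℚ sign b *ℚ Σ[< suc n ] (C⁻ ∘ toℕ)
      ≡⟨ ℚ.+-assoc (C⁺ 0) _ _ ⟩
    C⁺ 0 +ℚ (Σ[< suc n ] (C⁺ ∘ suc ∘ toℕ) +ℚ sign b *ℚ Σ[< suc n ] (C⁻ ∘ toℕ))
      ≡⟨ cong (λ v → C⁺ 0 +ℚ (Σ[< suc n ] (C⁺ ∘ suc ∘ toℕ) +ℚ v))
              (sym (Σ-distribˡ-* (suc n) (sign b) (C⁻ ∘ toℕ))) ⟩
    C⁺ 0 +ℚ (Σ[< suc n ] (C⁺ ∘ suc ∘ toℕ) +ℚ Σ[< suc n ] (λ i → sign b *ℚ C⁻ (toℕ i)))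
      ≡⟨ cong (C⁺ 0 +ℚ_) (sym (Σ-distrib-+ (suc n) (C⁺ ∘ suc ∘ toℕ) (λ i → sign b *ℚ C⁻ (toℕ i)))) ⟩
    Σ[< suc (suc n) ] (λ i → component (suc n) f (toℕ i) (b ∷ y)) ∎
  where
    open ≡-Reasoning
    C⁺ C⁻ : ℕ → ℚ
    C⁺ i = component n (part⁺ f) i y
    C⁻ i = component n (part⁻ f) i y
    sum⁺ : part⁺ f y ≡ Σ[< suc (suc n) ] (C⁺ ∘ toℕ)
    sum⁺ = begin
      part⁺ f y                              ≡⟨ component-sum n (part⁺ f) y ⟩
      Σ[< suc n ] (C⁺ ∘ toℕ)                  ≡⟨ sym (ℚ.+-identityʳ _) ⟩
      Σ[< suc n ] (C⁺ ∘ toℕ) +ℚ 0ℚ            ≡⟨ cong (Σ[< suc n ] (C⁺ ∘ toℕ) +ℚ_)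
                                                     (sym (component-above n (part⁺ f) (suc n) ℕ.≤-refl y)) ⟩
      Σ[< suc n ] (C⁺ ∘ toℕ) +ℚ C⁺ (suc n)    ≡⟨ sym (Σ-last (suc n) C⁺) ⟩
      Σ[< suc (suc n) ] (C⁺ ∘ toℕ)            ∎

canonical-decomposition : ∀ n f → IsDecomp n f (λ i → component n f (toℕ i))
canonical-decomposition n f = (λ i → component-eigen n f (toℕ i)) , component-sum n f

decomposition-unique : ∀ {n f g} → IsDecomp n f g → ∀ i → g i ≗ component n f (toℕ i)
decomposition-unique {n} {f} {g} (eg , sum-g) i x = x∙y⁻¹≈ε⇒x≈y _ _ (eigen-independent n
    (λ i → coef n (toℕ i)) (λ e → toℕ-injective (coef-injective n e))
    difference (λ i → eigen-⊕ {c = coef n (toℕ i)} {g i} (eg i)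
                   (eigen-neg {c = coef n (toℕ i)} {component n f (toℕ i)}
                              (component-eigen n f (toℕ i))))
    total i x)
  where
    open ≡-Reasoning
    difference : Fin (suc n) → Func n
    difference i x = g i x -ℚ component n f (toℕ i) x
    total : ∀ x → Σ[< suc n ] (λ i → difference i x) ≡ 0ℚ
    total x = begin
      Σ[< suc n ] (λ i → difference i x)
        ≡⟨ Σ-distrib-+ (suc n) (λ i → g i x) (λ i → - component n f (toℕ i) x) ⟩
      Σ[< suc n ] (λ i → g i x) +ℚ Σ[< suc n ] (λ i → - component n f (toℕ i) x)
        ≡⟨ cong₂ _+ℚ_ (sym (sum-g x)) (Σ-neg (suc n) (λ i → component n f (toℕ i) x)) ⟩
      f x -ℚ Σ[< suc n ] (λ i → component n f (toℕ i) x)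
        ≡⟨ cong (f x -ℚ_) (sym (component-sum n f x)) ⟩
      f x -ℚ f x
        ≡⟨ ℚ.+-inverseʳ (f x) ⟩
      0ℚ ∎

component-· : ∀ n {c} {f f′ : Func n} → f ≗ c · f′ → ∀ i → component n f i ≗ c · component n f′ i
component-· zero            e zero    x = e x
component-· zero    {c}     e (suc i) x = sym (ℚ.*-zeroʳ c)
component-· (suc n) {c} {f} {f′} e i (b ∷ y) = go i
  where
    e⁺ = part⁺-· {c = c} {f} {f′} e
    e⁻ = part⁻-· {c = c} {f} {f′} e
    factor : ∀ c u s v → c *ℚ u +ℚ s *ℚ (c *ℚ v) ≡ c *ℚ (u +ℚ s *ℚ v)
    factor = solve-∀ ℚ-ring
    go : ∀ i → component (suc n) f i (b ∷ y) ≡ c *ℚ component (suc n) f′ i (b ∷ y)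
    go zero    = component-· n {c} {part⁺ f} {part⁺ f′} e⁺ zero y
    go (suc i) =
      trans (cong₂ (λ u v → u +ℚ sign b *ℚ v)
                   (component-· n {c} {part⁺ f} {part⁺ f′} e⁺ (suc i) y)
                   (component-· n {c} {part⁻ f} {part⁻ f′} e⁻ i y))
            (factor c (component n (part⁺ f′) (suc i) y) (sign b) (component n (part⁻ f′) i y))

-- Spectra and ladders

Vanishes : ∀ n → Func n → ℕ → Set
Vanishes n f i = IsZero (component n f i)

SpectrumIs : ∀ n → Func n → Pred ℕ 0ℓ → Set
SpectrumIs n f R = ∀ i → (R i → ¬ Vanishes n f i) × (¬ R i → Vanishes n f i)

Shift : Pred ℕ 0ℓ → Pred ℕ 0ℓ
Shift P zero    = ⊥
Shift P (suc j) = P j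

spectrum-resp : ∀ {n f R R′} → R ≐ R′ → SpectrumIs n f R → SpectrumIs n f R′
spectrum-resp (R⊆R′ , R′⊆R) S i = (proj₁ (S i) ∘ R′⊆R) , (λ ¬r′ → proj₂ (S i) (¬r′ ∘ R⊆R′))

spectrum-scale : ∀ {n c f f′ R} → c ≢ 0ℚ → f ≗ c · f′ → SpectrumIs n f′ R → SpectrumIs n f R
spectrum-scale {n} {c} {f} {f′} c≢0 e S i =
    (λ r v → proj₁ (S i) r (λ x → *-cancelˡ-≢0 c≢0 (trans (sym (scaled x)) (v x))))
  , (λ ¬r x → trans (scaled x) (trans (cong (c *ℚ_) (proj₂ (S i) ¬r x)) (ℚ.*-zeroʳ c)))
  where
    scaled = component-· n {c} {f} {f′} e i

spectrum-null : ∀ {n f} → IsZero f → SpectrumIs n f ∅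
spectrum-null {n} {f} z i =
  (λ ()) , (λ _ x → trans (component-· n {0ℚ} {f} {f} (λ x → trans (z x) (sym (ℚ.*-zeroˡ (f x)))) i x)
                          (ℚ.*-zeroˡ (component n f i x)))

spectrum-dim0 : ∀ {f R} → f [] ≢ 0ℚ → R 0 → (∀ i → ¬ R (suc i)) → SpectrumIs 0 f R
spectrum-dim0 f≢0 r₀ _  zero    = (λ _ v → f≢0 (v [])) , (λ ¬r₀ → ⊥-elim (¬r₀ r₀))
spectrum-dim0 f≢0 r₀ ¬r (suc i) = (λ r _ → ¬r i r) , (λ _ _ → refl)

spectrum-split : ∀ {n f P Q} → SpectrumIs n (part⁺ f) P → SpectrumIs n (part⁻ f) Q
               → SpectrumIs (suc n) f (P ∪ Shift Q)
spectrum-split S⁺ S⁻ zero =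
    (λ { (inj₁ p) v → proj₁ (S⁺ 0) p (λ y → v (false ∷ y)) ; (inj₂ ()) })
  , (λ ¬r → λ { (b ∷ y) → proj₂ (S⁺ 0) (¬r ∘ inj₁) y })
spectrum-split S⁺ S⁻ (suc j) =
    (λ { (inj₁ p) v → proj₁ (S⁺ (suc j)) p (proj₁ (lifts-vanish v))
       ; (inj₂ q) v → proj₁ (S⁻ j) q (proj₂ (lifts-vanish v)) })
  , (λ ¬r → vanish-lifts (proj₂ (S⁺ (suc j)) (¬r ∘ inj₁)) (proj₂ (S⁻ j) (¬r ∘ inj₂)))

spectrum-lift⁺ : ∀ {n f P} → SpectrumIs n (part⁺ f) P → IsZero (part⁻ f) → SpectrumIs (suc n) f P
spectrum-lift⁺ S⁺ z =
  spectrum-resp ((λ { (inj₁ p) → p ; {zero} (inj₂ ()) ; {suc _} (inj₂ ()) }) , inj₁)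
                (spectrum-split S⁺ (spectrum-null z))

spectrum-lift⁻ : ∀ {n f Q} → IsZero (part⁺ f) → SpectrumIs n (part⁻ f) Q
               → SpectrumIs (suc n) f (Shift Q)
spectrum-lift⁻ z S⁻ = spectrum-resp ((λ { (inj₁ ()) ; (inj₂ q) → q }) , inj₂)
                                    (spectrum-split (spectrum-null z) S⁻)

data Gap : Set where
  one two : Gap

gapOf : ℕ → Gap
gapOf zero    = two
gapOf (suc _) = one

Rung : Gap → ℕ → ℕ → Set
Rung one A i = A ≤ i
Rung two A i = Σ ℕ λ t → i ≡ A + 2 * t

-- Ladder one A B and Ladder two A B are InInterval A B and InStep2 A B by definition.
Ladder : Gap → ℕ → ℕ → Pred ℕ 0ℓ
Ladder g A B i = Rung g A i × i ≤ B

-- With gap one a single rung is not enough: putting ψₖ in front would leave a hole at A + 1.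
Spans : Gap → ℕ → ℕ → Set
Spans one A B = A < B
Spans two A B = A ≤ B

spans-suc : ∀ g {A B} → Spans g A B → Spans g (suc A) (suc B)
spans-suc one = s≤s
spans-suc two = s≤s

spans-weaken : ∀ g {A B B′} → B ≤ B′ → Spans g A B → Spans g A B′
spans-weaken one B≤B′ A<B = ℕ.≤-trans A<B B≤B′
spans-weaken two B≤B′ A≤B = ℕ.≤-trans A≤B B≤B′

rung-≥ : ∀ g {A i} → Rung g A i → A ≤ i
rung-≥ one A≤i        = A≤i
rung-≥ two (t , refl) = ℕ.m≤m+n _ (2 * t)

rung-suc : ∀ g {A j} → Rung g A j → Rung g (suc A) (suc j)
rung-suc one A≤j     = s≤s A≤j
rung-suc two (t , e) = t , cong suc e

rung-pred : ∀ g {A j} → Rung g (suc A) (suc j) → Rung g A j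
rung-pred one (s≤s A≤j) = A≤j
rung-pred two (t , e)   = t , ℕ.suc-injective e

rung-lower : ∀ g {A i} → Rung g (suc (suc A)) i → Rung g A i
rung-lower one       r          = ℕ.m+n≤o⇒n≤o 2 r
rung-lower two {A} (t , refl) = suc t , shift A t
  where
    shift : ∀ A t → suc (suc A) + 2 * t ≡ A + 2 * suc t
    shift = ℕ-Ring.solve-∀

rung-next : ∀ g {A b j} → Spans g A b → b < suc j → Rung g A (suc j) → Rung g (suc A) j
rung-next one     A<b (s≤s b≤j) _              = ℕ.≤-trans A<b b≤j
rung-next two {A} A≤b (s≤s b≤j) (zero , e)     =
  ⊥-elim (ℕ.1+n≰n (ℕ.≤-trans (ℕ.≤-reflexive (trans e (ℕ.+-identityʳ A)))
                              (ℕ.≤-trans A≤b b≤j)))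
rung-next two {A} _   _         (suc t , e)    = t , ℕ.suc-injective (trans e (shift A t))
  where
    shift : ∀ A t → A + 2 * suc t ≡ suc (suc A + 2 * t)
    shift = ℕ-Ring.solve-∀

rung? : ∀ g A i → Dec (Rung g A i)
rung? one A i = A ≤? i
rung? two A i with A ≤? i | 2 ∣? (i ∸ A)
... | no A≰i | _ = no λ { (t , refl) → A≰i (ℕ.m≤m+n A (2 * t)) }
... | yes _ | no 2∤i∸A =
  no λ { (t , refl) → 2∤i∸A (divides t (trans (ℕ.m+n∸m≡n A (2 * t)) (ℕ.*-comm 2 t))) }
... | yes A≤i | yes (divides t i∸A≡t*2) =
  yes (t , trans (sym (ℕ.m+[n∸m]≡n A≤i)) (cong (λ m → A + m) (trans i∸A≡t*2 (ℕ.*-comm t 2))))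

ladder? : ∀ g A B → Decidable (Ladder g A B)
ladder? g A B i = rung? g A i ×-dec (i ≤? B)

ladder-weaken : ∀ g {A B B′} → B ≤ B′ → Ladder g A B ⊆ Ladder g A B′
ladder-weaken g B≤B′ (r , i≤B) = r , ℕ.≤-trans i≤B B≤B′

ladder-Shift : ∀ g {A B} → Shift (Ladder g A B) ≐ Ladder g (suc A) (suc B)
ladder-Shift g {A} {B} = to , from
  where
    to : Shift (Ladder g A B) ⊆ Ladder g (suc A) (suc B)
    to {suc j} (r , j≤B) = rung-suc g r , s≤s j≤B
    from : Ladder g (suc A) (suc B) ⊆ Shift (Ladder g A B)
    from {zero}  (r , _)         with () ← rung-≥ g r
    from {suc j} (r , s≤s j≤B) = rung-pred g r , j≤B

-- The spectra obtained by putting φₖ₊₁ resp. ψₖ₊₁ in front of a factor with spectrum a ladder.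
ladder-∪-Shift : ∀ g {A b₁ b₂} → b₁ ≤ suc b₂
               → Ladder g (suc A) b₁ ∪ Shift (Ladder g A b₂) ≐ Ladder g (suc A) (suc b₂)
ladder-∪-Shift g {A} {b₁} {b₂} b₁≤ = to , from
  where
    to : Ladder g (suc A) b₁ ∪ Shift (Ladder g A b₂) ⊆ Ladder g (suc A) (suc b₂)
    to (inj₁ l) = ladder-weaken g b₁≤ l
    to (inj₂ l) = proj₁ (ladder-Shift g) l
    from : Ladder g (suc A) (suc b₂) ⊆ Ladder g (suc A) b₁ ∪ Shift (Ladder g A b₂)
    from l = inj₂ (proj₂ (ladder-Shift g) l)

ladder-∪-Shift-next : ∀ g {A b₁ b₂} → b₁ ≤ suc b₂ → Spans g A b₁
                    → Ladder g A b₁ ∪ Shift (Ladder g (suc A) b₂) ≐ Ladder g A (suc b₂)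
ladder-∪-Shift-next g {A} {b₁} {b₂} b₁≤ spans = to , from
  where
    to : Ladder g A b₁ ∪ Shift (Ladder g (suc A) b₂) ⊆ Ladder g A (suc b₂)
    to         (inj₁ l)         = ladder-weaken g b₁≤ l
    to {suc j} (inj₂ (r , j≤b₂)) = rung-lower g (rung-suc g r) , s≤s j≤b₂
    from : Ladder g A (suc b₂) ⊆ Ladder g A b₁ ∪ Shift (Ladder g (suc A) b₂)
    from {zero}  (r , _) = inj₁ (r , z≤n)
    from {suc j} (r , sj≤sb₂) with suc j ≤? b₁
    ... | yes sj≤b₁ = inj₁ (r , sj≤b₁)
    ... | no  sj≰b₁ = inj₂ (rung-next g spans (ℕ.≰⇒> sj≰b₁) r , ℕ.≤-pred sj≤sb₂)

interval-∪-Shift : ∀ b → Ladder one 0 b ∪ Shift (Ladder one 0 b) ≐ Ladder one 0 (suc b)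
interval-∪-Shift b = to , from
  where
    to : Ladder one 0 b ∪ Shift (Ladder one 0 b) ⊆ Ladder one 0 (suc b)
    to         (inj₁ (_ , i≤b)) = z≤n , ℕ.m≤n⇒m≤1+n i≤b
    to {suc j} (inj₂ (_ , j≤b)) = z≤n , s≤s j≤b
    from : Ladder one 0 (suc b) ⊆ Ladder one 0 b ∪ Shift (Ladder one 0 b)
    from {zero}  _               = inj₁ (z≤n , z≤n)
    from {suc j} (_ , s≤s j≤b) = inj₂ (z≤n , j≤b)

-- Tensor products with the factors φ, ψ and I

⊗-·ˡ : ∀ {k m q} {g g′ : Func k} (H : Func m) → g ≗ q · g′ → g ⊗ H ≗ q · (g′ ⊗ H)
⊗-·ˡ {k} {q = q} {g′ = g′} H e y =
  trans (cong (_*ℚ H (drop k y)) (e (take k y))) (ℚ.*-assoc q (g′ (take k y)) (H (drop k y)))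

⊗-congˡ : ∀ {k m} {g g′ : Func k} (H : Func m) → g ≗ g′ → g ⊗ H ≗ g′ ⊗ H
⊗-congˡ {k} H e y = cong (_*ℚ H (drop k y)) (e (take k y))

part⁺-⊗ : ∀ {k m} (g : Func (suc k)) (H : Func m) → part⁺ (g ⊗ H) ≗ part⁺ g ⊗ H
part⁺-⊗ {k} g H y = factor (g (false ∷ take k y)) (g (true ∷ take k y)) (H (drop k y))
  where
    factor : ∀ u v h → ½ *ℚ (u *ℚ h +ℚ v *ℚ h) ≡ (½ *ℚ (u +ℚ v)) *ℚ h
    factor = solve-∀ ℚ-ring

part⁻-⊗ : ∀ {k m} (g : Func (suc k)) (H : Func m) → part⁻ (g ⊗ H) ≗ part⁻ g ⊗ H
part⁻-⊗ {k} g H y = factor (g (false ∷ take k y)) (g (true ∷ take k y)) (H (drop k y))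
  where
    factor : ∀ u v h → ½ *ℚ (u *ℚ h -ℚ v *ℚ h) ≡ (½ *ℚ (u -ℚ v)) *ℚ h
    factor = solve-∀ ℚ-ring

-- φ k = corners 1 (−1) k and ψ k = corners 1 1 k.
corners : ℚ → ℚ → (k : ℕ) → Func k
corners a b k x = if allFalse x then a else (if allTrue x then b else 0ℚ)

allFalse⇒¬allTrue : ∀ {k} (x : Point (suc k)) → allFalse x ≡ true → allTrue x ≡ false
allFalse⇒¬allTrue (false ∷ x) _ = refl

part⁺-corners : ∀ a b k → part⁺ (corners a b (suc (suc k))) ≗ ½ · corners a b (suc k)
part⁺-corners a b k x with allFalse x in f | allTrue x in t
... | true  | true  with () ← trans (sym t) (allFalse⇒¬allTrue x f)
... | true  | false = cong (½ *ℚ_) (ℚ.+-identityʳ a)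
... | false | true  = cong (½ *ℚ_) (ℚ.+-identityˡ b)
... | false | false = refl

part⁻-corners : ∀ a b k → part⁻ (corners a b (suc (suc k))) ≗ ½ · corners a (- b) (suc k)
part⁻-corners a b k x with allFalse x in f | allTrue x in t
... | true  | true  with () ← trans (sym t) (allFalse⇒¬allTrue x f)
... | true  | false = cong (½ *ℚ_) (ℚ.+-identityʳ a)
... | false | true  = cong (½ *ℚ_) (ℚ.+-identityˡ (- b))
... | false | false = refl

part⁺-I : ∀ k → part⁺ (I (suc k)) ≗ ½ · I k
part⁺-I k x = cong (½ *ℚ_) (ℚ.+-identityʳ (I k x))

part⁻-I : ∀ k → part⁻ (I (suc k)) ≗ ½ · I k
part⁻-I k x = cong (½ *ℚ_) (ℚ.+-identityʳ (I k x))

oddCeil evenCeil : ℕ → ℕ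
oddCeil zero     = 1
oddCeil (suc k)  = suc (evenCeil k)
evenCeil zero    = 0
evenCeil (suc k) = suc (oddCeil k)

ceil-adjacent : ∀ k → oddCeil k ≤ suc (evenCeil k) × evenCeil k ≤ suc (oddCeil k)
ceil-adjacent zero    = s≤s z≤n , z≤n
ceil-adjacent (suc k) = s≤s (proj₂ (ceil-adjacent k)) , s≤s (proj₁ (ceil-adjacent k))

1≤oddCeil : ∀ k → 1 ≤ oddCeil k
1≤oddCeil zero    = s≤s z≤n
1≤oddCeil (suc k) = s≤s z≤n

ceil-even : ∀ t → oddCeil (2 * t) ≡ suc (2 * t) × evenCeil (2 * t) ≡ 2 * t
ceil-even zero = refl , refl
ceil-even (suc t) = subst (λ m → oddCeil m ≡ suc m × evenCeil m ≡ m) (sym (ℕ.*-suc 2 t))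
  (cong (suc ∘ suc) (proj₁ (ceil-even t)) , cong (suc ∘ suc) (proj₂ (ceil-even t)))

LadderSpectrum : ∀ n → Func n → Gap → ℕ → ℕ → Set
LadderSpectrum n f g A B = Spans g A B × SpectrumIs n f (Ladder g A B)

-- ⊗List h (k ∷ ks) ⊗ R has the shape (h k ⊗ L) ⊗ M; its spectrum is found by induction on k.
module Front {a c : ℕ} (L : Func a) (M : Func c) where

  front : ∀ {k} → Func k → Func ((k + a) + c)
  front g = (g ⊗ L) ⊗ M

  front₀ : (g : Func 0) → front g ≗ g [] · (L ⊗ M)
  front₀ g y = ℚ.*-assoc (g []) (L (take a y)) (M (drop a y))

  part⁺-front : ∀ {k} (g : Func (suc k)) → part⁺ (front g) ≗ front (part⁺ g)
  part⁺-front g y = trans (part⁺-⊗ (g ⊗ L) M y) (⊗-congˡ M (part⁺-⊗ g L) y)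

  part⁻-front : ∀ {k} (g : Func (suc k)) → part⁻ (front g) ≗ front (part⁻ g)
  part⁻-front g y = trans (part⁻-⊗ (g ⊗ L) M y) (⊗-congˡ M (part⁻-⊗ g L) y)

  part⁺-front-· : ∀ {k q} {g : Func (suc k)} {g′ : Func k}
                → part⁺ g ≗ q · g′ → part⁺ (front g) ≗ q · front g′
  part⁺-front-· {q = q} {g} {g′} e y =
    trans (part⁺-front g y) (⊗-·ˡ {q = q} {g′ = g′ ⊗ L} M (⊗-·ˡ {q = q} {g′ = g′} L e) y)

  part⁻-front-· : ∀ {k q} {g : Func (suc k)} {g′ : Func k}
                → part⁻ g ≗ q · g′ → part⁻ (front g) ≗ q · front g′
  part⁻-front-· {q = q} {g} {g′} e y =
    trans (part⁻-front g y) (⊗-·ˡ {q = q} {g′ = g′ ⊗ L} M (⊗-·ˡ {q = q} {g′ = g′} L e) y)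

  module _ {g A B} (spans : Spans g A B) (S : SpectrumIs (a + c) (L ⊗ M) (Ladder g A B)) where

    front-spectra : ∀ k → SpectrumIs _ (front (φ (suc k))) (Ladder g (suc A) (oddCeil k + B))
                        × SpectrumIs _ (front (ψ (suc k))) (Ladder g A (evenCeil k + B))
    front-spectra zero =
        spectrum-resp (ladder-Shift g)
          (spectrum-lift⁻ (null (part⁺ (φ 1)) (part⁺-front (φ 1)) refl)
                          (unit (part⁻ (φ 1)) (part⁻-front (φ 1)) refl))
      , spectrum-lift⁺ (unit (part⁺ (ψ 1)) (part⁺-front (ψ 1)) refl)
                       (null (part⁻ (ψ 1)) (part⁻-front (ψ 1)) refl)
      where
        null : ∀ {F} (u : Func 0) → F ≗ front u → u [] ≡ 0ℚ → IsZero F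
        null u e u≡0 y =
          trans (e y) (trans (front₀ u y) (trans (cong (_*ℚ (L ⊗ M) y) u≡0) (ℚ.*-zeroˡ ((L ⊗ M) y))))
        unit : ∀ {F} (u : Func 0) → F ≗ front u → u [] ≡ 1ℚ → SpectrumIs (a + c) F (Ladder g A B)
        unit u e u≡1 =
          spectrum-scale ℚ.1≢0 (λ y → trans (e y) (trans (front₀ u y) (cong (_*ℚ (L ⊗ M) y) u≡1))) S
    front-spectra (suc k) =
        spectrum-resp (ladder-∪-Shift g (ℕ.+-monoˡ-≤ B (proj₁ (ceil-adjacent k))))
          (spectrum-split (half φ⁺ Sφ) (half φ⁻ Sψ))
      , spectrum-resp (ladder-∪-Shift-next g (ℕ.+-monoˡ-≤ B (proj₂ (ceil-adjacent k)))
                                             (spans-weaken g (ℕ.m≤n+m B (evenCeil k)) spans))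
          (spectrum-split (half ψ⁺ Sψ) (half ψ⁻ Sφ))
      where
        Sφ = proj₁ (front-spectra k)
        Sψ = proj₂ (front-spectra k)
        half : ∀ {n f f′ R} → f ≗ ½ · f′ → SpectrumIs n f′ R → SpectrumIs n f R
        half = spectrum-scale ½≢0
        φ⁺ : part⁺ (front (φ (2 + k))) ≗ ½ · front (φ (suc k))
        φ⁺ = part⁺-front-· {q = ½} {g = φ (2 + k)} {g′ = φ (suc k)} (part⁺-corners 1ℚ (- 1ℚ) k)
        φ⁻ : part⁻ (front (φ (2 + k))) ≗ ½ · front (ψ (suc k))
        φ⁻ = part⁻-front-· {q = ½} {g = φ (2 + k)} {g′ = ψ (suc k)} (part⁻-corners 1ℚ (- 1ℚ) k)
        ψ⁺ : part⁺ (front (ψ (2 + k))) ≗ ½ · front (ψ (suc k))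
        ψ⁺ = part⁺-front-· {q = ½} {g = ψ (2 + k)} {g′ = ψ (suc k)} (part⁺-corners 1ℚ 1ℚ k)
        ψ⁻ : part⁻ (front (ψ (2 + k))) ≗ ½ · front (φ (suc k))
        ψ⁻ = part⁻-front-· {q = ½} {g = ψ (2 + k)} {g′ = φ (suc k)} (part⁻-corners 1ℚ 1ℚ k)

  front-ladders : ∀ {g A B} → LadderSpectrum (a + c) (L ⊗ M) g A B → ∀ k
    → LadderSpectrum _ (front (φ (suc k))) g (suc A) (oddCeil k + B)
    × LadderSpectrum _ (front (ψ (suc k))) g A (evenCeil k + B)
  front-ladders {g} {A} {B} (spans , S) k =
      (spans-weaken g (ℕ.+-monoˡ-≤ B (1≤oddCeil k)) (spans-suc g spans)
      , proj₁ (front-spectra spans S k))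
    , (spans-weaken g (ℕ.m≤n+m B (evenCeil k)) spans , proj₂ (front-spectra spans S k))

odd-ceils : ∀ {k} → Odd (suc k) → oddCeil k ≡ suc k × evenCeil k ≡ k
odd-ceils (t , e) rewrite ℕ.suc-injective e = ceil-even t

even-oddCeil : ∀ {k} → Even (suc k) → oddCeil k ≡ k
even-oddCeil (suc t , e) rewrite ℕ.suc-injective (trans e (ℕ.*-suc 2 t)) =
  cong suc (proj₂ (ceil-even t))

ladder-⊗[] : ∀ h {N} {R : Func N} {g A B}
           → LadderSpectrum N R g A B → LadderSpectrum N (⊗List h [] ⊗ R) g A B
ladder-⊗[] h (spans , S) = spans , spectrum-scale ℚ.1≢0 (λ _ → refl) S

ladder-φs-odd : ∀ {ns} → AllPos Odd ns → ∀ {N} {R : Func N} {g A B} → LadderSpectrum N R g A B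
  → LadderSpectrum (sum ns + N) (⊗List φ ns ⊗ R) g (length ns + A) (sum ns + B)
ladder-φs-odd [] = ladder-⊗[] φ
ladder-φs-odd {suc k ∷ ns} ((_ , odd) ∷ ps) {R = R} {g} {A} {B} LS =
  subst (LadderSpectrum _ _ g _) top (proj₁ (front-ladders (ladder-φs-odd ps LS) k))
  where
    open Front (⊗List φ ns) R
    top : oddCeil k + (sum ns + B) ≡ (suc k + sum ns) + B
    top = trans (cong (_+ (sum ns + B)) (proj₁ (odd-ceils odd))) (sym (ℕ.+-assoc (suc k) (sum ns) B))

ladder-φs-even : ∀ {ms} → AllPos Even ms → ∀ {N} {R : Func N} {g A B} → LadderSpectrum N R g A B
  → LadderSpectrum (sum ms + N) (⊗List φ ms ⊗ R) g (length ms + A) (sum (map pred ms) + B)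
ladder-φs-even [] = ladder-⊗[] φ
ladder-φs-even {suc k ∷ ms} ((_ , even) ∷ ps) {R = R} {g} {A} {B} LS =
  subst (LadderSpectrum _ _ g _) top (proj₁ (front-ladders (ladder-φs-even ps LS) k))
  where
    open Front (⊗List φ ms) R
    top : oddCeil k + (sum (map pred ms) + B) ≡ (k + sum (map pred ms)) + B
    top = trans (cong (_+ (sum (map pred ms) + B)) (even-oddCeil even)) (sym (ℕ.+-assoc k _ B))

ladder-ψs-odd : ∀ {ns} → AllPos Odd ns → ∀ {N} {R : Func N} {g A B} → LadderSpectrum N R g A B
  → LadderSpectrum (sum ns + N) (⊗List ψ ns ⊗ R) g A (sum (map pred ns) + B)
ladder-ψs-odd [] = ladder-⊗[] ψ
ladder-ψs-odd {suc k ∷ ns} ((_ , odd) ∷ ps) {R = R} {g} {A} {B} LS =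
  subst (LadderSpectrum _ _ g A) top (proj₂ (front-ladders (ladder-ψs-odd ps LS) k))
  where
    open Front (⊗List ψ ns) R
    top : evenCeil k + (sum (map pred ns) + B) ≡ (k + sum (map pred ns)) + B
    top = trans (cong (_+ (sum (map pred ns) + B)) (proj₂ (odd-ceils odd))) (sym (ℕ.+-assoc k _ B))

interval-spectrum-I : ∀ r → SpectrumIs r (I r) (Ladder one 0 r)
interval-spectrum-I zero    = spectrum-dim0 ℚ.1≢0 (z≤n , z≤n) (λ _ ())
interval-spectrum-I (suc r) = spectrum-resp (interval-∪-Shift r)
  (spectrum-split (spectrum-scale ½≢0 (part⁺-I r) S) (spectrum-scale ½≢0 (part⁻-I r) S))
  where S = interval-spectrum-I r

ladder-I : ∀ r → LadderSpectrum r (I r) (gapOf r) 0 r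
ladder-I zero    = z≤n , spectrum-dim0 ℚ.1≢0 ((0 , refl) , z≤n) (λ _ ())
ladder-I (suc r) = s≤s z≤n , interval-spectrum-I (suc r)

-- Support sizes

count : ∀ {n} → Func n → List (Point n) → ℕ
count f xs = length (filter (λ x → ¬? (f x ≟ 0ℚ)) xs)

indicator : ℚ → ℕ
indicator q = if does (q ≟ 0ℚ) then 0 else 1

count-∷ : ∀ {n} (f : Func n) x xs → count f (x ∷ xs) ≡ indicator (f x) + count f xs
count-∷ f x xs with f x ≟ 0ℚ
... | yes _ = refl
... | no  _ = refl

count-pairs : ∀ {n} (f : Func (suc n)) xs
  → count f (concatMap (λ v → (false ∷ v) ∷ (true ∷ v) ∷ []) xs)
  ≡ count (λ y → f (false ∷ y)) xs + count (λ y → f (true ∷ y)) xs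
count-pairs f []       = refl
count-pairs f (v ∷ vs) = begin
    count f ((false ∷ v) ∷ (true ∷ v) ∷ rest)
      ≡⟨ count-∷ f _ _ ⟩
    i₀ + count f ((true ∷ v) ∷ rest)
      ≡⟨ cong (λ m → i₀ + m) (count-∷ f _ _) ⟩
    i₀ + (i₁ + count f rest)
      ≡⟨ cong (λ m → i₀ + (i₁ + m)) (count-pairs f vs) ⟩
    i₀ + (i₁ + (count f₀ vs + count f₁ vs))
      ≡⟨ interchange i₀ i₁ (count f₀ vs) (count f₁ vs) ⟩
    (i₀ + count f₀ vs) + (i₁ + count f₁ vs)
      ≡⟨ sym (cong₂ _+_ (count-∷ f₀ v vs) (count-∷ f₁ v vs)) ⟩
    count f₀ (v ∷ vs) + count f₁ (v ∷ vs) ∎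
  where
    open ≡-Reasoning
    rest = concatMap (λ v → (false ∷ v) ∷ (true ∷ v) ∷ []) vs
    f₀ f₁ : Func _
    f₀ y = f (false ∷ y)
    f₁ y = f (true ∷ y)
    i₀ = indicator (f (false ∷ v))
    i₁ = indicator (f (true ∷ v))
    interchange : ∀ a b c d → a + (b + (c + d)) ≡ (a + c) + (b + d)
    interchange = ℕ-Ring.solve-∀

supp-split : ∀ {n} (f : Func (suc n))
           → supp f ≡ supp (λ y → f (false ∷ y)) + supp (λ y → f (true ∷ y))
supp-split {n} f = count-pairs f (allPoints n)

supp-resp : ∀ {n} {f g : Func n} → (∀ x → f x ≡ 0ℚ → g x ≡ 0ℚ) → (∀ x → g x ≡ 0ℚ → f x ≡ 0ℚ)
          → supp f ≡ supp g
supp-resp {n} {f} {g} f⇒g g⇒f =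
  cong length (filter-≐ (λ x → ¬? (f x ≟ 0ℚ)) (λ x → ¬? (g x ≟ 0ℚ))
                        ((λ {x} f≢0 → f≢0 ∘ g⇒f x) , (λ {x} g≢0 → g≢0 ∘ f⇒g x)) (allPoints n))

supp-zero : ∀ {n} {f : Func n} → IsZero f → supp f ≡ 0
supp-zero {n} {f} z =
  cong length (filter-none (λ x → ¬? (f x ≟ 0ℚ)) (universal (λ x f≢0 → f≢0 (z x)) (allPoints n)))

supp-⊗ : ∀ {m n} (g : Func m) (H : Func n) → supp (g ⊗ H) ≡ supp g * supp H
supp-⊗ {zero} {n} g H with g [] ≟ 0ℚ
... | yes g≡0 = supp-zero (λ y → trans (cong (_*ℚ H y) g≡0) (ℚ.*-zeroˡ (H y)))
... | no  g≢0 =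
  trans (supp-resp {n} {g ⊗ H} {H} (λ _ → *-cancelˡ-≢0 g≢0)
                                   (λ _ H≡0 → trans (cong (g [] *ℚ_) H≡0) (ℚ.*-zeroʳ (g []))))
        (sym (ℕ.+-identityʳ (supp H)))
supp-⊗ {suc m} g H = begin
    supp (g ⊗ H)                                ≡⟨ supp-split (g ⊗ H) ⟩
    supp (g₀ ⊗ H) + supp (g₁ ⊗ H)               ≡⟨ cong₂ _+_ (supp-⊗ g₀ H) (supp-⊗ g₁ H) ⟩
    supp g₀ * supp H + supp g₁ * supp H         ≡⟨ sym (ℕ.*-distribʳ-+ (supp H) (supp g₀) (supp g₁)) ⟩
    (supp g₀ + supp g₁) * supp H                ≡⟨ cong (_* supp H) (sym (supp-split g)) ⟩
    supp g * supp H                             ∎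
  where
    open ≡-Reasoning
    g₀ g₁ : Func m
    g₀ y = g (false ∷ y)
    g₁ y = g (true ∷ y)

supp₀ : (f : Func 0) → f [] ≢ 0ℚ → supp f ≡ 1
supp₀ f f≢0 = cong length (filter-accept (λ x → ¬? (f x ≟ 0ℚ)) f≢0)

supp-origin : ∀ {a} → a ≢ 0ℚ → ∀ k → supp {k} (λ x → if allFalse x then a else 0ℚ) ≡ 1
supp-origin {a} a≢0 zero    = supp₀ (λ x → if allFalse x then a else 0ℚ) a≢0
supp-origin {a} a≢0 (suc k) = trans (supp-split {k} (λ x → if allFalse x then a else 0ℚ))
                                    (cong₂ _+_ (supp-origin a≢0 k) (supp-zero {k} {λ _ → 0ℚ} (λ _ → refl)))

supp-antipode : ∀ {b} → b ≢ 0ℚ → ∀ k → supp {k} (λ x → if allTrue x then b else 0ℚ) ≡ 1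
supp-antipode {b} b≢0 zero    = supp₀ (λ x → if allTrue x then b else 0ℚ) b≢0
supp-antipode {b} b≢0 (suc k) = trans (supp-split {k} (λ x → if allTrue x then b else 0ℚ))
                                      (cong₂ _+_ (supp-zero {k} {λ _ → 0ℚ} (λ _ → refl)) (supp-antipode b≢0 k))

supp-corners : ∀ {a b} → a ≢ 0ℚ → b ≢ 0ℚ → ∀ k → supp (corners a b (suc k)) ≡ 2
supp-corners a≢0 b≢0 k =
  trans (supp-split (corners _ _ (suc k))) (cong₂ _+_ (supp-origin a≢0 k) (supp-antipode b≢0 k))

supp-⊗List : ∀ h → (∀ k → supp (h (suc k)) ≡ 2)
           → ∀ {P ns} → AllPos P ns → supp (⊗List h ns) ≡ 2 ^ length ns
supp-⊗List h supp-h []                        = refl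
supp-⊗List h supp-h {ns = suc k ∷ _} (_ ∷ ps) =
  trans (supp-⊗ (h (suc k)) _) (cong₂ _*_ (supp-h k) (supp-⊗List h supp-h ps))

in-range : ∀ {n f g A B} → SpectrumIs n f (Ladder g A B) → InURange n A B f
in-range {n} {f} {g} S = (λ i → component n f (toℕ i)) , canonical-decomposition n f , outside
  where
    outside : ∀ i → (toℕ i < _ ⊎ _ < toℕ i) → IsZero (component n f (toℕ i))
    outside i (inj₁ i<A) = proj₂ (S (toℕ i)) (λ (r , _)   → ℕ.<⇒≱ i<A (rung-≥ g r))
    outside i (inj₂ B<i) = proj₂ (S (toℕ i)) (λ (_ , i≤B) → ℕ.<⇒≱ B<i i≤B)

spectrum-via : ∀ {n f R g} → SpectrumIs n f R → Decidable R → IsDecomp n f g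
             → ∀ i → (InSpecVia g i → R (toℕ i)) × (R (toℕ i) → InSpecVia g i)
spectrum-via {n} {f} {R} {g} S R? d i =
    (λ g≢0 → decidable-stable (R? (toℕ i)) (λ ¬r → g≢0 (λ x → trans (same x) (proj₂ (S (toℕ i)) ¬r x))))
  , (λ r g≡0 → proj₁ (S (toℕ i)) r (λ x → trans (sym (same x)) (g≡0 x)))
  where
    same = decomposition-unique d i

conclusion : ∀ {n f a b s} r → SpectrumIs n f (Ladder (gapOf r) a b) → supp f ≡ s
           → Conclusion n f a b s r
conclusion {a = a} {b} zero    S refl =
  in-range S , refl , λ g d i → (λ ()) , (λ _ → spectrum-via S (ladder? two a b) d i)
conclusion {a = a} {b} (suc r) S refl =
  in-range S , refl , λ g d i → (λ _ → spectrum-via S (ladder? one a b) d i) , (λ ())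

sum-map-pred : ∀ {P ns} → AllPos P ns → sum (map pred ns) + length ns ≡ sum ns
sum-map-pred []                                   = refl
sum-map-pred {ns = suc k ∷ ns} ((s≤s z≤n , _) ∷ ps) =
  trans (regroup k (sum (map pred ns)) (length ns)) (cong (λ m → suc (k + m)) (sum-map-pred ps))
  where
    regroup : ∀ k s l → (k + s) + suc l ≡ suc (k + (s + l))
    regroup = ℕ-Ring.solve-∀

∸-cancel : ∀ {m n o} → m ≡ n + o → m ∸ o ≡ n
∸-cancel {n = n} {o} refl = ℕ.m+n∸n≡m n o

top-φ : ∀ {ns ms} → AllPos Even ms → ∀ r
      → sum ns + (sum (map pred ms) + r) ≡ sum ns + (sum ms + r) ∸ length ms
top-φ {ns} {ms} even r = sym (∸-cancel (trans
    (cong (λ m → sum ns + (m + r)) (sym (sum-map-pred even)))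
    (regroup (sum ns) (sum (map pred ms)) (length ms) r)))
  where
    regroup : ∀ s p l r → s + ((p + l) + r) ≡ (s + (p + r)) + l
    regroup = ℕ-Ring.solve-∀

top-ψ : ∀ {ns ms} → AllPos Odd ns → AllPos Even ms → ∀ r
      → sum (map pred ns) + (sum (map pred ms) + r) ≡ sum ns + (sum ms + r) ∸ length ns ∸ length ms
top-ψ {ns} {ms} odd even r = sym (∸-cancel (∸-cancel (trans
    (cong₂ (λ u v → u + (v + r)) (sym (sum-map-pred odd)) (sym (sum-map-pred even)))
    (regroup (sum (map pred ns)) (length ns) (sum (map pred ms)) (length ms) r))))
  where
    regroup : ∀ q k p l r → (q + k) + ((p + l) + r) ≡ ((q + (p + r)) + l) + k
    regroup = ℕ-Ring.solve-∀

supp-φ : ∀ k → supp (φ (suc k)) ≡ 2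
supp-φ = supp-corners ℚ.1≢0 (λ ())

supp-ψ : ∀ k → supp (ψ (suc k)) ≡ 2
supp-ψ = supp-corners ℚ.1≢0 ℚ.1≢0

supp-factors : ∀ h → (∀ k → supp (h (suc k)) ≡ 2) → ∀ {P ns ms} → AllPos P ns → AllPos Even ms
             → ∀ r → supp (⊗List h ns ⊗ (⊗List φ ms ⊗ I r)) ≡ 2 ^ (length ns + length ms)
supp-factors h supp-h {ns = ns} {ms} ps even r = begin
    supp (⊗List h ns ⊗ (⊗List φ ms ⊗ I r))
      ≡⟨ supp-⊗ (⊗List h ns) _ ⟩
    supp (⊗List h ns) * supp (⊗List φ ms ⊗ I r)
      ≡⟨ cong (supp (⊗List h ns) *_) (supp-⊗ (⊗List φ ms) (I r)) ⟩
    supp (⊗List h ns) * (supp (⊗List φ ms) * supp (I r))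
      ≡⟨ cong₂ (λ u v → u * (v * supp (I r))) (supp-⊗List h supp-h ps) (supp-⊗List φ supp-φ even) ⟩
    2 ^ length ns * (2 ^ length ms * supp (I r))
      ≡⟨ cong (λ v → 2 ^ length ns * (2 ^ length ms * v)) (supp-origin ℚ.1≢0 r) ⟩
    2 ^ length ns * (2 ^ length ms * 1)
      ≡⟨ cong (2 ^ length ns *_) (ℕ.*-identityʳ (2 ^ length ms)) ⟩
    2 ^ length ns * 2 ^ length ms
      ≡⟨ sym (ℕ.^-distribˡ-+-* 2 (length ns) (length ms)) ⟩
    2 ^ (length ns + length ms) ∎
  where open ≡-Reasoning

lemma16 : (ns ms : List ℕ) (r : ℕ)
    → AllPos Odd ns → AllPos Even ms
    → 1 ≤ sum ns + (sum ms + r)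
    → let n = sum ns + (sum ms + r)
          k = length ns
          l = length ms
      in Conclusion n (⊗List φ ns ⊗ (⊗List φ ms ⊗ I r)) (k + l) (n ∸ l) (2 ^ (k + l)) r
       × Conclusion n (⊗List ψ ns ⊗ (⊗List φ ms ⊗ I r)) l (n ∸ k ∸ l) (2 ^ (k + l)) r
lemma16 ns ms r odd even _ =
    conclusion r (retarget (cong (λ m → length ns + m) (ℕ.+-identityʳ (length ms))) (top-φ {ns} even r)
                           (ladder-φs-odd odd middle))
                 (supp-factors φ supp-φ odd even r)
  , conclusion r (retarget (ℕ.+-identityʳ (length ms)) (top-ψ odd even r) (ladder-ψs-odd odd middle))
                 (supp-factors ψ supp-ψ odd even r)
  where
    middle = ladder-φs-even even (ladder-I r)
    retarget : ∀ {n f A A′ B B′} → A ≡ A′ → B ≡ B′ → LadderSpectrum n f (gapOf r) A B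
             → SpectrumIs n f (Ladder (gapOf r) A′ B′)
    retarget refl refl = proj₂
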